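{- Let $\Gamma\subset\mathbb{F}_q[x]^2$ be an $\mathbb{F}_q[x]$-lattice of rank $2$ with $\mathrm{vol}(\Gamma)=q^m$, and let $r,s\ge0$ be integers. Then the number of primitive vectors $v=(g,h)\in\Gamma$ ($g,h\in\mathbb{F}_q[x]$) with $\deg g\le r$ and $\deg h\le s$ is at most $\max(q,q^{r+s-m+2})$.
   Context: An $\mathbb{F}_q[x]$-lattice of rank $n$ is an $\mathbb{F}_q[x]$-submodule $\Gamma\subset\mathbb{F}_q[x]^n$ of finite index; its volume is $\mathrm{vol}(\Gamma)=[\mathbb{F}_q[x]^n:\Gamma]$. A vector $v\in\Gamma$ is primitive in $\Gamma$ if it cannot be written as $v=aw$ with $w\in\Gamma$, $a\in\mathbb{F}_q[x]$, $\deg a\ge1$. -}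

module Defs where

open import Level using (0ℓ)
open import Algebra.Bundles using (CommutativeRing)
open import Data.Nat using (ℕ; zero; suc; _≤_; _<_)
open import Data.Fin using (Fin)
open import Data.List using (List; []; _∷_; map)
open import Data.Product using (_×_; _,_; ∃; Σ)
open import Data.Unit using (⊤)
open import Relation.Nullary using (¬_)
open import Relation.Binary.PropositionalEquality using (_≡_)

record FiniteField : Set₁ where
  field
    cring : CommutativeRing 0ℓ 0ℓ
  open CommutativeRing cring public
  field
    0≉1       : ¬ (0# ≈ 1#)
    inverse   : ∀ x → ¬ (x ≈ 0#) → ∃ λ y → (x * y) ≈ 1#
    q         : ℕ
    enum      : Fin q → Carrier
    enum-surj : ∀ x → ∃ λ i → enum i ≈ x
    enum-inj  : ∀ i j → enum i ≈ enum j → i ≡ j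

module Over (F : FiniteField) where
  open FiniteField F

  -- Polynomials in F[x]: coefficient lists, constant term first.
  Poly : Set
  Poly = List Carrier

  -- Equality of polynomials (equal up to trailing zero coefficients).
  infix 4 _≈ₚ_
  _≈ₚ_ : Poly → Poly → Set
  [] ≈ₚ [] = ⊤
  [] ≈ₚ (b ∷ bs) = (b ≈ 0#) × ([] ≈ₚ bs)
  (a ∷ as) ≈ₚ [] = (a ≈ 0#) × (as ≈ₚ [])
  (a ∷ as) ≈ₚ (b ∷ bs) = (a ≈ b) × (as ≈ₚ bs)

  infixl 6 _+ₚ_
  _+ₚ_ : Poly → Poly → Poly
  [] +ₚ g = g
  (a ∷ f) +ₚ [] = a ∷ f
  (a ∷ f) +ₚ (b ∷ g) = (a + b) ∷ (f +ₚ g)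

  -ₚ_ : Poly → Poly
  -ₚ f = map -_ f

  _·ₚ_ : Carrier → Poly → Poly
  c ·ₚ f = map (c *_) f

  infixl 7 _*ₚ_
  _*ₚ_ : Poly → Poly → Poly
  [] *ₚ g = []
  (a ∷ f) *ₚ g = (a ·ₚ g) +ₚ (0# ∷ (f *ₚ g))

  coeff : Poly → ℕ → Carrier
  coeff [] i = 0#
  coeff (a ∷ f) zero = a
  coeff (a ∷ f) (suc i) = coeff f i

  -- deg f ≤ r  (with deg 0 = -∞): all coefficients beyond index r vanish
  DegLe : ℕ → Poly → Set
  DegLe r f = ∀ i → r < i → coeff f i ≈ 0#

  DegGe1 : Poly → Set
  DegGe1 a = ∃ λ i → 1 ≤ i × ¬ (coeff a i ≈ 0#)

  Vec2 : Set
  Vec2 = Poly × Poly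

  infix 4 _≈v_
  _≈v_ : Vec2 → Vec2 → Set
  (g , h) ≈v (g' , h') = (g ≈ₚ g') × (h ≈ₚ h')

  _+v_ : Vec2 → Vec2 → Vec2
  (g , h) +v (g' , h') = (g +ₚ g') , (h +ₚ h')

  _-v_ : Vec2 → Vec2 → Vec2
  (g , h) -v (g' , h') = (g +ₚ (-ₚ g')) , (h +ₚ (-ₚ h'))

  _∙v_ : Poly → Vec2 → Vec2
  a ∙v (g , h) = (a *ₚ g) , (a *ₚ h)

  record Submodule2 : Set₁ where
    field
      mem      : Vec2 → Set
      mem-resp : ∀ {u v} → u ≈v v → mem u → mem v
      mem-0    : mem ([] , [])
      mem-+    : ∀ {u v} → mem u → mem v → mem (u +v v)
      mem-∙    : ∀ a {u} → mem u → mem (a ∙v u)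
  open Submodule2 public

  -- [F[x]^2 : Γ] = N : there is a complete system of N pairwise
  -- inequivalent coset representatives of F[x]^2 / Γ.
  HasIndex : Submodule2 → ℕ → Set
  HasIndex Γ N = Σ (Fin N → Vec2) λ rep →
      (∀ i j → mem Γ (rep i -v rep j) → i ≡ j)
    × (∀ v → ∃ λ i → mem Γ (v -v rep i))

  Primitive : Submodule2 → Vec2 → Set
  Primitive Γ v = mem Γ v × ¬ (∃ λ a → ∃ λ w → mem Γ w × DegGe1 a × (v ≈v (a ∙v w)))

module Submission where

-- If all the vectors are F_q-multiples of the first one, there are at most q of them. Otherwise take two
-- non-proportional ones u and w and run a Euclid-style reduction of (u , w) inside Γ, measuring (g , h) by
-- max (deg g + s , deg h + r). Primitive vectors with a common factor in Γ are proportional, so the reduction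
-- ends with e₁, e₂ ∈ Γ whose leading coefficient pairs are linearly independent over F_q. Translating the N
-- vectors by all a xⁱ e₁ + b xʲ e₂ raises the degree bounds by one and multiplies their number by q², so
-- after K steps there are N q^(2K) distinct vectors of Γ with deg g ≤ r + K and deg h ≤ s + K; adding
-- representatives of the q^m cosets of Γ gives N q^(2K+m) distinct vectors in a set of size q^(r+s+2+2K).
-- Hence N ≤ q^(r+s+2-m).

open import Defs

import Algebra.Properties.CommutativeSemigroup as CommSemigroupProperties
import Algebra.Properties.Ring as RingProperties
open import Data.Empty using (⊥-elim)
open import Data.Fin as Fin using (Fin; remQuot; combine; funToFin; finToFun; toℕ)
import Data.Fin.Properties as Finₚ
open import Data.List using ([]; _∷_; length)
open import Data.Nat as ℕ using (ℕ; zero; suc; z≤n; s≤s; _≤_; _<_; _∸_; _^_; _⊔_)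
import Data.Nat.Properties as ℕₚ
open import Data.Nat.Tactic.RingSolver using (solve-∀)
open import Data.Product using (∃; ∃₂; _×_; _,_; proj₁; proj₂)
open import Data.Sum using (_⊎_; inj₁; inj₂)
open import Data.Unit using (tt)
open import Function using (_∘_; case_of_)
open import Relation.Nullary using (¬_; Dec; yes; no; contradiction)
open import Relation.Nullary.Decidable using (map′; _×-dec_; _→-dec_)
import Relation.Binary.PropositionalEquality as ≡
open ≡ using (_≡_)
import Relation.Binary.Reasoning.Setoid as SetoidReasoning

data Truncation (L a : ℕ) : Set where
  exact     : a ≤ L → Truncation L a
  truncated : suc L ∸ a ≡ 0 → L ∸ a ≡ 0 → Truncation L a

truncation : ∀ L a → Truncation L a
truncation L a with ℕₚ.≤-<-connex a L
... | inj₁ a≤L = exact a≤L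
... | inj₂ L<a = truncated (ℕₚ.m≤n⇒m∸n≡0 L<a) (ℕₚ.m≤n⇒m∸n≡0 (ℕₚ.<⇒≤ L<a))

remQuot-injective : ∀ {m} n (i j : Fin (m ℕ.* n)) → remQuot {m} n i ≡ remQuot n j → i ≡ j
remQuot-injective {m} n i j e =
  ≡.trans (≡.sym (Finₚ.combine-remQuot {m} n i))
    (≡.trans (≡.cong (λ (a , b) → combine a b) e) (Finₚ.combine-remQuot {m} n j))

bounded : ∀ n (f : Fin n → ℕ) → ∃ λ K → ∀ i → f i ≤ K
bounded zero f = 0 , λ ()
bounded (suc n) f =
  let K , f≤K = bounded n (f ∘ Fin.suc)
  in f Fin.zero ⊔ K , λ { Fin.zero → ℕₚ.m≤m⊔n _ _ ; (Fin.suc i) → ℕₚ.≤-trans (f≤K i) (ℕₚ.m≤n⊔m _ _) }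

[q*q]^k≡q^[k+k] : ∀ q k → (q ℕ.* q) ^ k ≡ q ^ (k ℕ.+ k)
[q*q]^k≡q^[k+k] q zero = ≡.refl
[q*q]^k≡q^[k+k] q (suc k) = begin
  (q ℕ.* q) ℕ.* (q ℕ.* q) ^ k   ≡⟨ ≡.cong ((q ℕ.* q) ℕ.*_) ([q*q]^k≡q^[k+k] q k) ⟩
  (q ℕ.* q) ℕ.* q ^ (k ℕ.+ k)   ≡⟨ ℕₚ.*-assoc q q _ ⟩
  q ℕ.* (q ℕ.* q ^ (k ℕ.+ k))   ≡⟨ ≡.cong (λ e → q ℕ.* q ^ e) (ℕₚ.+-suc k k) ⟨
  q ℕ.* q ^ (k ℕ.+ suc k)       ∎
  where open ≡.≡-Reasoning

n*q^[m+c]≤q^[x+c]⇒n≤q^[x∸m] : ∀ q n x m c → 2 ≤ q → n ℕ.* q ^ (m ℕ.+ c) ≤ q ^ (x ℕ.+ c) → n ≤ q ^ (x ∸ m)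
n*q^[m+c]≤q^[x+c]⇒n≤q^[x∸m] q n x m c 2≤q n*q^[m+c]≤q^[x+c] with m ℕ.≤? x
... | yes m≤x = ℕₚ.*-cancelʳ-≤ n (q ^ (x ∸ m)) (q ^ (m ℕ.+ c)) {{ℕₚ.m^n≢0 q (m ℕ.+ c)}}
      (≡.subst (n ℕ.* q ^ (m ℕ.+ c) ≤_) q^[x+c]≡q^[x∸m]*q^[m+c] n*q^[m+c]≤q^[x+c])
  where
  instance
    q≢0 : ℕ.NonZero q
    q≢0 = ℕ.>-nonZero (ℕₚ.≤-trans (s≤s z≤n) 2≤q)
  q^[x+c]≡q^[x∸m]*q^[m+c] : q ^ (x ℕ.+ c) ≡ q ^ (x ∸ m) ℕ.* q ^ (m ℕ.+ c)
  q^[x+c]≡q^[x∸m]*q^[m+c] =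
    ≡.trans (≡.cong (λ y → q ^ (y ℕ.+ c)) (≡.sym (ℕₚ.m∸n+n≡m m≤x)))
      (≡.trans (≡.cong (q ^_) (ℕₚ.+-assoc (x ∸ m) m c)) (ℕₚ.^-distribˡ-+-* q (x ∸ m) (m ℕ.+ c)))
... | no m≰x = ℕₚ.≤-trans (ℕₚ.m<1+n⇒m≤n n<1) z≤n
  where
  n<1 : n < 1
  n<1 = ℕₚ.*-cancelʳ-< (q ^ (m ℕ.+ c)) n 1 (ℕₚ.≤-<-trans n*q^[m+c]≤q^[x+c]
          (≡.subst (q ^ (x ℕ.+ c) <_) (≡.sym (ℕₚ.*-identityˡ _))
            (ℕₚ.^-monoʳ-< q 2≤q (ℕₚ.+-monoˡ-< c (ℕₚ.≰⇒> m≰x)))))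

module Polynomials (F : FiniteField) where

  open FiniteField F renaming (refl to ≈-refl; sym to ≈-sym; trans to ≈-trans; reflexive to ≈-reflexive)
  open RingProperties ring
    using (-‿distribˡ-*; -0#≈0#; -‿+-comm; -1*x≈-x; +-inverseʳ-unique; x∙y⁻¹≈ε⇒x≈y; +-cancelʳ)
  open CommSemigroupProperties +-commutativeSemigroup using () renaming (interchange to +-interchange)
  open SetoidReasoning setoid
  open Over F

  index : Carrier → Fin q
  index x = proj₁ (enum-surj x)

  enum-index : ∀ x → enum (index x) ≈ x
  enum-index x = proj₂ (enum-surj x)

  index-injective : ∀ {x y} → index x ≡ index y → x ≈ y
  index-injective {x} {y} e = ≈-trans (≈-sym (enum-index x)) (≈-trans (≈-reflexive (≡.cong enum e)) (enum-index y))

  _≟_ : ∀ x y → Dec (x ≈ y)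
  x ≟ y = map′ index-injective
                (λ x≈y → enum-inj _ _ (≈-trans (enum-index x) (≈-trans x≈y (≈-sym (enum-index y)))))
                (index x Fin.≟ index y)

  2≤q : 2 ≤ q
  2≤q = Finₚ.injective⇒≤ {f = zero-or-one} injective
    where
    zero-or-one : Fin 2 → Fin q
    zero-or-one Fin.zero = index 0#
    zero-or-one (Fin.suc _) = index 1#
    injective : ∀ {i j} → zero-or-one i ≡ zero-or-one j → i ≡ j
    injective {Fin.zero} {Fin.zero} _ = ≡.refl
    injective {Fin.zero} {Fin.suc Fin.zero} e = ⊥-elim (0≉1 (index-injective e))
    injective {Fin.suc Fin.zero} {Fin.zero} e = ⊥-elim (0≉1 (index-injective (≡.sym e)))
    injective {Fin.suc Fin.zero} {Fin.suc Fin.zero} _ = ≡.refl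

  *-cancelˡ-inverse : ∀ {y y' z w} → y * y' ≈ 1# → y * z ≈ w → z ≈ y' * w
  *-cancelˡ-inverse {y} {y'} {z} {w} yy'≈1 yz≈w = begin
    z            ≈⟨ *-identityˡ z ⟨
    1# * z       ≈⟨ *-congʳ (≈-trans (≈-sym yy'≈1) (*-comm y y')) ⟩
    (y' * y) * z ≈⟨ *-assoc y' y z ⟩
    y' * (y * z) ≈⟨ *-congˡ yz≈w ⟩
    y' * w       ∎

  +-exchange : ∀ {a a' b b'} → a + b ≈ a' + b' → b - b' ≈ a' - a
  +-exchange {a} {a'} {b} {b'} e = begin
    b - b'                 ≈⟨ +-congʳ b≈-a+[a+b] ⟩
    (- a + (a + b)) - b'   ≈⟨ +-congʳ (+-congˡ e) ⟩
    (- a + (a' + b')) - b' ≈⟨ +-assoc _ _ _ ⟩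
    - a + ((a' + b') - b') ≈⟨ +-congˡ (+-assoc _ _ _) ⟩
    - a + (a' + (b' - b')) ≈⟨ +-congˡ (≈-trans (+-congˡ (-‿inverseʳ b')) (+-identityʳ a')) ⟩
    - a + a'               ≈⟨ +-comm _ _ ⟩
    a' - a                 ∎
    where
    b≈-a+[a+b] : b ≈ - a + (a + b)
    b≈-a+[a+b] = ≈-sym (≈-trans (≈-sym (+-assoc _ _ _)) (≈-trans (+-congʳ (-‿inverseˡ a)) (+-identityˡ b)))

  x≉0∧xy≈0⇒y≈0 : ∀ {x y} → ¬ (x ≈ 0#) → x * y ≈ 0# → y ≈ 0#
  x≉0∧xy≈0⇒y≈0 {x} x≉0 xy≈0 with inverse x x≉0
  ... | x' , xx'≈1 = ≈-trans (*-cancelˡ-inverse xx'≈1 xy≈0) (zeroʳ x')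

  -- Linear algebra in F²

  Pair : Set
  Pair = Carrier × Carrier

  infix 4 _≈²_
  _≈²_ : Pair → Pair → Set
  t ≈² t' = (proj₁ t ≈ proj₁ t') × (proj₂ t ≈ proj₂ t')

  ≈²-sym : ∀ {t t'} → t ≈² t' → t' ≈² t
  ≈²-sym (e , e') = ≈-sym e , ≈-sym e'

  ≈²-trans : ∀ {t t' t''} → t ≈² t' → t' ≈² t'' → t ≈² t''
  ≈²-trans (e , e') (f , f') = ≈-trans e f , ≈-trans e' f'

  IsZero² : Pair → Set
  IsZero² t = t ≈² (0# , 0#)

  IsZero²? : ∀ t → Dec (IsZero² t)
  IsZero²? t = (proj₁ t ≟ 0#) ×-dec (proj₂ t ≟ 0#)

  infixl 6 _+²_
  infixr 7 _·²_

  _+²_ : Pair → Pair → Pair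
  t +² t' = proj₁ t + proj₁ t' , proj₂ t + proj₂ t'

  _·²_ : Carrier → Pair → Pair
  x ·² t = x * proj₁ t , x * proj₂ t

  +²-cong : ∀ {t t' u u'} → t ≈² t' → u ≈² u' → t +² u ≈² t' +² u'
  +²-cong (e , e') (f , f') = +-cong e f , +-cong e' f'

  +²-zeroˡ : ∀ {t} u → IsZero² t → t +² u ≈² u
  +²-zeroˡ u (z , z') = ≈-trans (+-congʳ z) (+-identityˡ _) , ≈-trans (+-congʳ z') (+-identityˡ _)

  OnlyTrivial : Pair → Pair → Carrier → Carrier → Set
  OnlyTrivial t₁ t₂ x y = IsZero² (x ·² t₁ +² y ·² t₂) → IsZero² (x , y)

  Independent : Pair → Pair → Set
  Independent t₁ t₂ = ∀ x y → OnlyTrivial t₁ t₂ x y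

  Dependent : Pair → Pair → Set
  Dependent t₁ t₂ = ∃₂ λ x y → IsZero² (x ·² t₁ +² y ·² t₂) × ¬ IsZero² (x , y)

  OnlyTrivial-cong : ∀ t₁ t₂ {x x' y y'} → x ≈ x' → y ≈ y' → OnlyTrivial t₁ t₂ x' y' → OnlyTrivial t₁ t₂ x y
  OnlyTrivial-cong t₁ t₂ {x} {x'} {y} {y'} x≈x' y≈y' only-trivial (z₁ , z₂) =
    let x'≈0 , y'≈0 = only-trivial (≈-trans (combination-cong (proj₁ t₁) (proj₁ t₂)) z₁ ,
                                    ≈-trans (combination-cong (proj₂ t₁) (proj₂ t₂)) z₂)
    in ≈-trans x≈x' x'≈0 , ≈-trans y≈y' y'≈0
    where
    combination-cong : ∀ a b → x' * a + y' * b ≈ x * a + y * b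
    combination-cong a b = +-cong (*-congʳ (≈-sym x≈x')) (*-congʳ (≈-sym y≈y'))

  OnlyTrivial? : ∀ t₁ t₂ x y → Dec (OnlyTrivial t₁ t₂ x y)
  OnlyTrivial? t₁ t₂ x y = IsZero²? (x ·² t₁ +² y ·² t₂) →-dec IsZero²? (x , y)

  -- Independence is decided by trying all q² coefficient pairs.
  independent-or-dependent : ∀ t₁ t₂ → Independent t₁ t₂ ⊎ Dependent t₁ t₂
  independent-or-dependent t₁ t₂ with Finₚ.all? (λ i → Finₚ.all? (λ j → OnlyTrivial? t₁ t₂ (enum i) (enum j)))
  ... | yes onlyTrivial = inj₁ λ x y →
    OnlyTrivial-cong t₁ t₂ (≈-sym (enum-index x)) (≈-sym (enum-index y)) (onlyTrivial (index x) (index y))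
  ... | no ¬onlyTrivial
    with i , ¬onlyTrivialᵢ ← Finₚ.¬∀⟶∃¬ q _ (λ i → Finₚ.all? (OnlyTrivial? t₁ t₂ (enum i) ∘ enum)) ¬onlyTrivial
    with j , ¬onlyTrivialᵢⱼ ← Finₚ.¬∀⟶∃¬ q _ (OnlyTrivial? t₁ t₂ (enum i) ∘ enum) ¬onlyTrivialᵢ
    with IsZero²? (enum i ·² t₁ +² enum j ·² t₂)
  ... | yes relation = inj₂ (enum i , enum j , relation , λ trivial → ¬onlyTrivialᵢⱼ (λ _ → trivial))
  ... | no ¬relation = ⊥-elim (¬onlyTrivialᵢⱼ (λ relation → contradiction relation ¬relation))

  Dependent-sym : ∀ {t₁ t₂} → Dependent t₁ t₂ → Dependent t₂ t₁
  Dependent-sym (x , y , (z , z') , xy≉0) =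
    y , x , (≈-trans (+-comm _ _) z , ≈-trans (+-comm _ _) z') , λ (y≈0 , x≈0) → xy≉0 (x≈0 , y≈0)

  dependent⇒proportional : ∀ {t₁ t₂} → ¬ IsZero² t₁ → Dependent t₁ t₂ → ∃ λ c → t₂ ≈² c ·² t₁
  dependent⇒proportional {t₁} {t₂} t₁≉0 (x , y , (z₁ , z₂) , xy≉0) with y ≟ 0#
  ... | yes y≈0 = ⊥-elim (t₁≉0 (x≉0∧xy≈0⇒y≈0 x≉0 (drop z₁) , x≉0∧xy≈0⇒y≈0 x≉0 (drop z₂)))
    where
    x≉0 : ¬ (x ≈ 0#)
    x≉0 x≈0 = xy≉0 (x≈0 , y≈0)
    drop : ∀ {a b} → x * a + y * b ≈ 0# → x * a ≈ 0#
    drop {a} {b} relation = begin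
      x * a          ≈⟨ +-identityʳ _ ⟨
      x * a + 0#     ≈⟨ +-congˡ (≈-trans (*-congʳ y≈0) (zeroˡ b)) ⟨
      x * a + y * b  ≈⟨ relation ⟩
      0#             ∎
  ... | no y≉0 with y' , yy'≈1 ← inverse y y≉0 = y' * (- x) , solve z₁ , solve z₂
    where
    solve : ∀ {a b} → x * a + y * b ≈ 0# → b ≈ (y' * (- x)) * a
    solve {a} {b} relation = begin
      b                ≈⟨ *-cancelˡ-inverse yy'≈1 (+-inverseʳ-unique (x * a) (y * b) relation) ⟩
      y' * (- (x * a)) ≈⟨ *-congˡ (-‿distribˡ-* x a) ⟩
      y' * ((- x) * a) ≈⟨ *-assoc _ _ _ ⟨
      (y' * (- x)) * a ∎

  independent⇒injective : ∀ {t₁ t₂} → Independent t₁ t₂ → ∀ {x x' y y'} →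
    x ·² t₁ +² y ·² t₂ ≈² x' ·² t₁ +² y' ·² t₂ → (x ≈ x') × (y ≈ y')
  independent⇒injective {t₁} {t₂} independent {x} {x'} {y} {y'} (e₁ , e₂) =
    let x-x'≈0 , y-y'≈0 = independent (x - x') (y - y') (difference e₁ , difference e₂)
    in x∙y⁻¹≈ε⇒x≈y x x' x-x'≈0 , x∙y⁻¹≈ε⇒x≈y y y' y-y'≈0
    where
    difference : ∀ {a b} → x * a + y * b ≈ x' * a + y' * b → (x - x') * a + (y - y') * b ≈ 0#
    difference {a} {b} e = begin
      (x - x') * a + (y - y') * b                 ≈⟨ +-cong (distribʳ a x (- x')) (distribʳ b y (- y')) ⟩
      (x * a + (- x') * a) + (y * b + (- y') * b) ≈⟨ +-interchange _ _ _ _ ⟩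
      (x * a + y * b) + ((- x') * a + (- y') * b) ≈⟨ +-congˡ (+-cong (-‿distribˡ-* x' a) (-‿distribˡ-* y' b)) ⟨
      (x * a + y * b) + (- (x' * a) + - (y' * b)) ≈⟨ +-cong e (-‿+-comm _ _) ⟩
      (x' * a + y' * b) - (x' * a + y' * b)       ≈⟨ -‿inverseʳ _ ⟩
      0#                                          ∎

  -- Polynomials up to coefficientwise equality

  infix 4 _≋_
  record _≋_ (f g : Poly) : Set where
    constructor mk≋
    field at : ∀ i → coeff f i ≈ coeff g i
  open _≋_

  ≋-refl : ∀ {f} → f ≋ f
  ≋-refl = mk≋ λ _ → ≈-refl

  ≋-sym : ∀ {f g} → f ≋ g → g ≋ f
  ≋-sym p = mk≋ λ i → ≈-sym (at p i)

  ≋-trans : ∀ {f g h} → f ≋ g → g ≋ h → f ≋ h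
  ≋-trans p p' = mk≋ λ i → ≈-trans (at p i) (at p' i)

  ∷-cong : ∀ {a b f g} → a ≈ b → f ≋ g → a ∷ f ≋ b ∷ g
  ∷-cong a≈b p = mk≋ λ { zero → a≈b ; (suc i) → at p i }

  ≋-tail : ∀ {a b f g} → a ∷ f ≋ b ∷ g → f ≋ g
  ≋-tail p = mk≋ (at p ∘ suc)

  ≈ₚ⇒≋ : ∀ {f g} → f ≈ₚ g → f ≋ g
  ≈ₚ⇒≋ {[]} {[]} _ = ≋-refl
  ≈ₚ⇒≋ {[]} {b ∷ g} (b≈0 , p) = mk≋ λ { zero → ≈-sym b≈0 ; (suc i) → at (≈ₚ⇒≋ p) i }
  ≈ₚ⇒≋ {a ∷ f} {[]} (a≈0 , p) = mk≋ λ { zero → a≈0 ; (suc i) → at (≈ₚ⇒≋ p) i }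
  ≈ₚ⇒≋ {a ∷ f} {b ∷ g} (a≈b , p) = ∷-cong a≈b (≈ₚ⇒≋ p)

  ≋⇒≈ₚ : ∀ {f g} → f ≋ g → f ≈ₚ g
  ≋⇒≈ₚ {[]} {[]} _ = tt
  ≋⇒≈ₚ {[]} {b ∷ g} p = ≈-sym (at p 0) , ≋⇒≈ₚ (mk≋ (at p ∘ suc))
  ≋⇒≈ₚ {a ∷ f} {[]} p = at p 0 , ≋⇒≈ₚ (mk≋ (at p ∘ suc))
  ≋⇒≈ₚ {a ∷ f} {b ∷ g} p = at p 0 , ≋⇒≈ₚ (≋-tail p)

  _≋?_ : ∀ f g → Dec (f ≋ g)
  f ≋? g = map′ ≈ₚ⇒≋ ≋⇒≈ₚ (≈ₚ? f g)
    where
    ≈ₚ? : ∀ f g → Dec (f ≈ₚ g)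
    ≈ₚ? [] [] = yes tt
    ≈ₚ? [] (b ∷ g) = (b ≟ 0#) ×-dec ≈ₚ? [] g
    ≈ₚ? (a ∷ f) [] = (a ≟ 0#) ×-dec ≈ₚ? f []
    ≈ₚ? (a ∷ f) (b ∷ g) = (a ≟ b) ×-dec ≈ₚ? f g

  coeff-+ₚ : ∀ f g i → coeff (f +ₚ g) i ≈ coeff f i + coeff g i
  coeff-+ₚ [] g i = ≈-sym (+-identityˡ _)
  coeff-+ₚ (a ∷ f) [] zero = ≈-sym (+-identityʳ _)
  coeff-+ₚ (a ∷ f) [] (suc i) = ≈-sym (+-identityʳ _)
  coeff-+ₚ (a ∷ f) (b ∷ g) zero = ≈-refl
  coeff-+ₚ (a ∷ f) (b ∷ g) (suc i) = coeff-+ₚ f g i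

  coeff-negₚ : ∀ f i → coeff (-ₚ f) i ≈ - coeff f i
  coeff-negₚ [] i = ≈-sym -0#≈0#
  coeff-negₚ (a ∷ f) zero = ≈-refl
  coeff-negₚ (a ∷ f) (suc i) = coeff-negₚ f i

  coeff-·ₚ : ∀ c f i → coeff (c ·ₚ f) i ≈ c * coeff f i
  coeff-·ₚ c [] i = ≈-sym (zeroʳ c)
  coeff-·ₚ c (a ∷ f) zero = ≈-refl
  coeff-·ₚ c (a ∷ f) (suc i) = coeff-·ₚ c f i

  +ₚ-pointwise : ∀ f g f' g' → (∀ i → coeff f i + coeff g i ≈ coeff f' i + coeff g' i) → f +ₚ g ≋ f' +ₚ g'
  +ₚ-pointwise f g f' g' e = mk≋ λ i → ≈-trans (coeff-+ₚ f g i) (≈-trans (e i) (≈-sym (coeff-+ₚ f' g' i)))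

  +ₚ-cong : ∀ {f f' g g'} → f ≋ f' → g ≋ g' → f +ₚ g ≋ f' +ₚ g'
  +ₚ-cong {f} {f'} {g} {g'} p p' = +ₚ-pointwise f g f' g' λ i → +-cong (at p i) (at p' i)

  ·ₚ-cong : ∀ {c c' f f'} → c ≈ c' → f ≋ f' → c ·ₚ f ≋ c' ·ₚ f'
  ·ₚ-cong {c} {c'} {f} {f'} c≈c' p = mk≋ λ i →
    ≈-trans (coeff-·ₚ c f i) (≈-trans (*-cong c≈c' (at p i)) (≈-sym (coeff-·ₚ c' f' i)))

  +ₚ-comm : ∀ f g → f +ₚ g ≋ g +ₚ f
  +ₚ-comm f g = +ₚ-pointwise f g g f λ _ → +-comm _ _

  +ₚ-identityʳ : ∀ f → f +ₚ [] ≋ f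
  +ₚ-identityʳ f = mk≋ λ i → ≈-trans (coeff-+ₚ f [] i) (+-identityʳ _)

  +ₚ-assoc : ∀ f g h → (f +ₚ g) +ₚ h ≋ f +ₚ (g +ₚ h)
  +ₚ-assoc f g h = mk≋ λ i → begin
    coeff ((f +ₚ g) +ₚ h) i             ≈⟨ ≈-trans (coeff-+ₚ (f +ₚ g) h i) (+-congʳ (coeff-+ₚ f g i)) ⟩
    (coeff f i + coeff g i) + coeff h i ≈⟨ +-assoc _ _ _ ⟩
    coeff f i + (coeff g i + coeff h i) ≈⟨ ≈-trans (coeff-+ₚ f (g +ₚ h) i) (+-congˡ (coeff-+ₚ g h i)) ⟨
    coeff (f +ₚ (g +ₚ h)) i             ∎

  +ₚ-interchange : ∀ f g h k → (f +ₚ g) +ₚ (h +ₚ k) ≋ (f +ₚ h) +ₚ (g +ₚ k)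
  +ₚ-interchange f g h k = +ₚ-pointwise (f +ₚ g) (h +ₚ k) (f +ₚ h) (g +ₚ k) λ i → begin
    coeff (f +ₚ g) i + coeff (h +ₚ k) i               ≈⟨ +-cong (coeff-+ₚ f g i) (coeff-+ₚ h k i) ⟩
    (coeff f i + coeff g i) + (coeff h i + coeff k i) ≈⟨ +-interchange _ _ _ _ ⟩
    (coeff f i + coeff h i) + (coeff g i + coeff k i) ≈⟨ +-cong (coeff-+ₚ f h i) (coeff-+ₚ g k i) ⟨
    coeff (f +ₚ h) i + coeff (g +ₚ k) i               ∎

  +ₚ-cancelʳ : ∀ {f f' g g'} → f +ₚ g ≋ f' +ₚ g' → g ≋ g' → f ≋ f'
  +ₚ-cancelʳ {f} {f'} {g} {g'} e p = mk≋ λ i → +-cancelʳ (coeff g i) (coeff f i) (coeff f' i) (begin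
    coeff f i + coeff g i   ≈⟨ coeff-+ₚ f g i ⟨
    coeff (f +ₚ g) i        ≈⟨ at e i ⟩
    coeff (f' +ₚ g') i      ≈⟨ coeff-+ₚ f' g' i ⟩
    coeff f' i + coeff g' i ≈⟨ +-congˡ (at p i) ⟨
    coeff f' i + coeff g i  ∎)

  -ₚ-inverseʳ : ∀ f g → (f +ₚ (-ₚ g)) +ₚ g ≋ f
  -ₚ-inverseʳ f g = mk≋ λ i → begin
    coeff ((f +ₚ (-ₚ g)) +ₚ g) i        ≈⟨ coeff-+ₚ (f +ₚ (-ₚ g)) g i ⟩
    coeff (f +ₚ (-ₚ g)) i + coeff g i   ≈⟨ +-congʳ (≈-trans (coeff-+ₚ f (-ₚ g) i) (+-congˡ (coeff-negₚ g i))) ⟩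
    (coeff f i - coeff g i) + coeff g i ≈⟨ +-assoc _ _ _ ⟩
    coeff f i + (- coeff g i + coeff g i) ≈⟨ +-congˡ (-‿inverseˡ _) ⟩
    coeff f i + 0#                      ≈⟨ +-identityʳ _ ⟩
    coeff f i                           ∎

  0·ₚ : ∀ g → 0# ·ₚ g ≋ []
  0·ₚ g = mk≋ λ i → ≈-trans (coeff-·ₚ 0# g i) (zeroˡ _)

  1·ₚ : ∀ g → 1# ·ₚ g ≋ g
  1·ₚ g = mk≋ λ i → ≈-trans (coeff-·ₚ 1# g i) (*-identityˡ _)

  -1·ₚ : ∀ g → (- 1#) ·ₚ g ≋ -ₚ g
  -1·ₚ g = mk≋ λ i → ≈-trans (coeff-·ₚ (- 1#) g i) (≈-trans (-1*x≈-x _) (≈-sym (coeff-negₚ g i)))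

  ·ₚ-assoc : ∀ c b g → (c * b) ·ₚ g ≋ c ·ₚ (b ·ₚ g)
  ·ₚ-assoc c b g = mk≋ λ i → begin
    coeff ((c * b) ·ₚ g) i    ≈⟨ coeff-·ₚ (c * b) g i ⟩
    (c * b) * coeff g i       ≈⟨ *-assoc _ _ _ ⟩
    c * (b * coeff g i)       ≈⟨ ≈-trans (coeff-·ₚ c (b ·ₚ g) i) (*-congˡ (coeff-·ₚ b g i)) ⟨
    coeff (c ·ₚ (b ·ₚ g)) i   ∎

  ·ₚ-exchange : ∀ b c g → b ·ₚ (c ·ₚ g) ≋ c ·ₚ (b ·ₚ g)
  ·ₚ-exchange b c g = ≋-trans (≋-sym (·ₚ-assoc b c g)) (≋-trans (·ₚ-cong (*-comm b c) ≋-refl) (·ₚ-assoc c b g))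

  ·ₚ-distribʳ : ∀ a b g → (a + b) ·ₚ g ≋ (a ·ₚ g) +ₚ (b ·ₚ g)
  ·ₚ-distribʳ a b g = mk≋ λ i →
    ≈-trans (coeff-·ₚ (a + b) g i) (≈-trans (distribʳ _ _ _)
      (≈-sym (≈-trans (coeff-+ₚ (a ·ₚ g) (b ·ₚ g) i) (+-cong (coeff-·ₚ a g i) (coeff-·ₚ b g i)))))

  ·ₚ-distribˡ : ∀ c f g → c ·ₚ (f +ₚ g) ≋ (c ·ₚ f) +ₚ (c ·ₚ g)
  ·ₚ-distribˡ c f g = mk≋ λ i →
    ≈-trans (coeff-·ₚ c (f +ₚ g) i) (≈-trans (*-congˡ (coeff-+ₚ f g i)) (≈-trans (distribˡ _ _ _)
      (≈-sym (≈-trans (coeff-+ₚ (c ·ₚ f) (c ·ₚ g) i) (+-cong (coeff-·ₚ c f i) (coeff-·ₚ c g i))))))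

  0∷-zero : ∀ {f} → f ≋ [] → 0# ∷ f ≋ []
  0∷-zero p = mk≋ λ { zero → ≈-refl ; (suc i) → at p i }

  *ₚ-zeroˡ : ∀ {a} g → a ≋ [] → a *ₚ g ≋ []
  *ₚ-zeroˡ {[]} g _ = ≋-refl
  *ₚ-zeroˡ {x ∷ a} g p =
    +ₚ-cong (≋-trans (·ₚ-cong (at p 0) ≋-refl) (0·ₚ g)) (0∷-zero (*ₚ-zeroˡ {a} g (mk≋ (at p ∘ suc))))

  *ₚ-zeroʳ : ∀ a → a *ₚ [] ≋ []
  *ₚ-zeroʳ [] = ≋-refl
  *ₚ-zeroʳ (x ∷ a) = 0∷-zero (*ₚ-zeroʳ a)

  *ₚ-congˡ : ∀ {a a'} g → a ≋ a' → a *ₚ g ≋ a' *ₚ g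
  *ₚ-congˡ {[]} g p = ≋-sym (*ₚ-zeroˡ g (≋-sym p))
  *ₚ-congˡ {x ∷ a} {[]} g p = *ₚ-zeroˡ g p
  *ₚ-congˡ {x ∷ a} {y ∷ a'} g p = +ₚ-cong (·ₚ-cong (at p 0) ≋-refl) (∷-cong ≈-refl (*ₚ-congˡ g (≋-tail p)))

  *ₚ-congʳ : ∀ a {g g'} → g ≋ g' → a *ₚ g ≋ a *ₚ g'
  *ₚ-congʳ [] p = ≋-refl
  *ₚ-congʳ (x ∷ a) p = +ₚ-cong (·ₚ-cong ≈-refl p) (∷-cong ≈-refl (*ₚ-congʳ a p))

  *ₚ-distribʳ : ∀ a b g → (a +ₚ b) *ₚ g ≋ (a *ₚ g) +ₚ (b *ₚ g)
  *ₚ-distribʳ [] b g = ≋-refl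
  *ₚ-distribʳ (x ∷ a) [] g = ≋-sym (+ₚ-identityʳ _)
  *ₚ-distribʳ (x ∷ a) (y ∷ b) g = ≋-trans
    (+ₚ-cong (·ₚ-distribʳ x y g) (∷-cong (≈-sym (+-identityˡ 0#)) (*ₚ-distribʳ a b g)))
    (+ₚ-interchange (x ·ₚ g) (y ·ₚ g) (0# ∷ (a *ₚ g)) (0# ∷ (b *ₚ g)))

  *ₚ-distribˡ : ∀ a g h → a *ₚ (g +ₚ h) ≋ (a *ₚ g) +ₚ (a *ₚ h)
  *ₚ-distribˡ [] g h = ≋-refl
  *ₚ-distribˡ (x ∷ a) g h = ≋-trans
    (+ₚ-cong (·ₚ-distribˡ x g h) (∷-cong (≈-sym (+-identityˡ 0#)) (*ₚ-distribˡ a g h)))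
    (+ₚ-interchange (x ·ₚ g) (x ·ₚ h) (0# ∷ (a *ₚ g)) (0# ∷ (a *ₚ h)))

  *ₚ-·ₚʳ : ∀ a c g → a *ₚ (c ·ₚ g) ≋ c ·ₚ (a *ₚ g)
  *ₚ-·ₚʳ [] c g = ≋-refl
  *ₚ-·ₚʳ (x ∷ a) c g = ≋-trans
    (+ₚ-cong (·ₚ-exchange x c g) (∷-cong (≈-sym (zeroʳ c)) (*ₚ-·ₚʳ a c g)))
    (≋-sym (·ₚ-distribˡ c (x ·ₚ g) (0# ∷ (a *ₚ g))))

  *ₚ-·ₚˡ : ∀ a c g → (c ·ₚ a) *ₚ g ≋ c ·ₚ (a *ₚ g)
  *ₚ-·ₚˡ [] c g = ≋-refl
  *ₚ-·ₚˡ (x ∷ a) c g = ≋-trans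
    (+ₚ-cong (·ₚ-assoc c x g) (∷-cong (≈-sym (zeroʳ c)) (*ₚ-·ₚˡ a c g)))
    (≋-sym (·ₚ-distribˡ c (x ·ₚ g) (0# ∷ (a *ₚ g))))

  shift : ℕ → Poly → Poly
  shift zero g = g
  shift (suc k) g = 0# ∷ shift k g

  monomial : Carrier → ℕ → Poly
  monomial c k = shift k (c ∷ [])

  shift-cong : ∀ k {f g} → f ≋ g → shift k f ≋ shift k g
  shift-cong zero p = p
  shift-cong (suc k) p = ∷-cong ≈-refl (shift-cong k p)

  *ₚ-0∷ˡ : ∀ a g → (0# ∷ a) *ₚ g ≋ 0# ∷ (a *ₚ g)
  *ₚ-0∷ˡ a g = +ₚ-cong (0·ₚ g) ≋-refl

  *ₚ-0∷ʳ : ∀ a g → a *ₚ (0# ∷ g) ≋ 0# ∷ (a *ₚ g)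
  *ₚ-0∷ʳ [] g = ≋-sym (0∷-zero ≋-refl)
  *ₚ-0∷ʳ (x ∷ a) g = ∷-cong (≈-trans (+-identityʳ _) (zeroʳ x)) (+ₚ-cong ≋-refl (*ₚ-0∷ʳ a g))

  *ₚ-shiftˡ : ∀ a k g → shift k a *ₚ g ≋ shift k (a *ₚ g)
  *ₚ-shiftˡ a zero g = ≋-refl
  *ₚ-shiftˡ a (suc k) g = ≋-trans (*ₚ-0∷ˡ (shift k a) g) (∷-cong ≈-refl (*ₚ-shiftˡ a k g))

  *ₚ-shiftʳ : ∀ a k g → a *ₚ shift k g ≋ shift k (a *ₚ g)
  *ₚ-shiftʳ a zero g = ≋-refl
  *ₚ-shiftʳ a (suc k) g = ≋-trans (*ₚ-0∷ʳ a (shift k g)) (∷-cong ≈-refl (*ₚ-shiftʳ a k g))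

  constant-*ₚ : ∀ c g → (c ∷ []) *ₚ g ≋ c ·ₚ g
  constant-*ₚ c g = ≋-trans (+ₚ-cong ≋-refl (0∷-zero ≋-refl)) (+ₚ-identityʳ (c ·ₚ g))

  monomial-*ₚ : ∀ c k g → monomial c k *ₚ g ≋ shift k (c ·ₚ g)
  monomial-*ₚ c k g = ≋-trans (*ₚ-shiftˡ (c ∷ []) k g) (shift-cong k (constant-*ₚ c g))

  *ₚ-monomial-swap : ∀ a c k g → a *ₚ (monomial c k *ₚ g) ≋ (monomial c k *ₚ a) *ₚ g
  *ₚ-monomial-swap a c k g =
    ≋-trans (*ₚ-congʳ a (monomial-*ₚ c k g))
    (≋-trans (*ₚ-shiftʳ a k (c ·ₚ g))
    (≋-trans (shift-cong k (≋-trans (*ₚ-·ₚʳ a c g) (≋-sym (*ₚ-·ₚˡ a c g))))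
    (≋-trans (≋-sym (*ₚ-shiftˡ (c ·ₚ a) k g))
             (*ₚ-congˡ g (≋-sym (monomial-*ₚ c k a))))))

  -- Degree bounds

  record DegLt (n : ℕ) (f : Poly) : Set where
    constructor degLt
    field vanishes : ∀ i → n ≤ i → coeff f i ≈ 0#
  open DegLt

  DegLt-resp : ∀ {n f g} → f ≋ g → DegLt n f → DegLt n g
  DegLt-resp p (degLt d) = degLt λ i n≤i → ≈-trans (≈-sym (at p i)) (d i n≤i)

  DegLt-mono : ∀ {n n' f} → n ≤ n' → DegLt n f → DegLt n' f
  DegLt-mono n≤n' (degLt d) = degLt λ i n'≤i → d i (ℕₚ.≤-trans n≤n' n'≤i)

  DegLt-+ₚ : ∀ {n f g} → DegLt n f → DegLt n g → DegLt n (f +ₚ g)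
  DegLt-+ₚ {f = f} {g} (degLt d) (degLt d') = degLt λ i n≤i →
    ≈-trans (coeff-+ₚ f g i) (≈-trans (+-cong (d i n≤i) (d' i n≤i)) (+-identityʳ 0#))

  DegLt-negₚ : ∀ {n f} → DegLt n f → DegLt n (-ₚ f)
  DegLt-negₚ {f = f} (degLt d) = degLt λ i n≤i → ≈-trans (coeff-negₚ f i) (≈-trans (-‿cong (d i n≤i)) -0#≈0#)

  DegLt-·ₚ : ∀ {n f} c → DegLt n f → DegLt n (c ·ₚ f)
  DegLt-·ₚ {f = f} c (degLt d) = degLt λ i n≤i → ≈-trans (coeff-·ₚ c f i) (≈-trans (*-congˡ (d i n≤i)) (zeroʳ c))

  DegLt-length : ∀ f → DegLt (length f) f
  DegLt-length [] = degLt λ _ _ → ≈-refl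
  DegLt-length (a ∷ f) = degLt λ { (suc i) (s≤s n≤i) → vanishes (DegLt-length f) i n≤i }

  DegLt-zero : ∀ {n f} → f ≋ [] → DegLt n f
  DegLt-zero p = degLt λ i _ → at p i

  DegLt0⇒≋[] : ∀ {f} → DegLt 0 f → f ≋ []
  DegLt0⇒≋[] (degLt d) = mk≋ λ i → d i z≤n

  DegLt-step : ∀ {n f} → DegLt (suc n) f → coeff f n ≈ 0# → DegLt n f
  DegLt-step (degLt d) top≈0 = degLt λ i n≤i → case ℕₚ.m≤n⇒m<n∨m≡n n≤i of λ where
    (inj₁ n<i) → d i n<i
    (inj₂ ≡.refl) → top≈0

  DegLt-shift : ∀ k {n f} → DegLt n f → DegLt (k ℕ.+ n) (shift k f)
  DegLt-shift zero d = d
  DegLt-shift (suc k) d = degLt λ { (suc i) (s≤s k+n≤i) → vanishes (DegLt-shift k d) i k+n≤i }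

  coeff-shift : ∀ k f i → coeff (shift k f) (k ℕ.+ i) ≡ coeff f i
  coeff-shift zero f i = ≡.refl
  coeff-shift (suc k) f i = coeff-shift k f i

  shift-zero : ∀ k {f} → f ≋ [] → shift k f ≋ []
  shift-zero zero p = p
  shift-zero (suc k) p = 0∷-zero (shift-zero k p)

  DegLt-step∸ : ∀ L a {f} → DegLt (suc L ∸ a) f → coeff f (L ∸ a) ≈ 0# → DegLt (L ∸ a) f
  DegLt-step∸ L a d top≈0 with truncation L a
  ... | exact a≤L rewrite ℕₚ.+-∸-assoc 1 a≤L = DegLt-step d top≈0
  ... | truncated e e' rewrite e | e' = d

  DegLt-shift∸ : ∀ L a k {f} → DegLt (L ∸ a) f → DegLt ((k ℕ.+ L) ∸ a) (shift k f)
  DegLt-shift∸ L a k d with truncation L a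
  ... | exact a≤L rewrite ℕₚ.+-∸-assoc k a≤L = DegLt-shift k d
  ... | truncated _ e rewrite e = DegLt-zero (shift-zero k (DegLt0⇒≋[] d))

  coeff-shift∸ : ∀ L a k {f} → DegLt (suc L ∸ a) f → coeff (shift k f) ((k ℕ.+ L) ∸ a) ≈ coeff f (L ∸ a)
  coeff-shift∸ L a k {f} d with truncation L a
  ... | exact a≤L rewrite ℕₚ.+-∸-assoc k a≤L | coeff-shift k f (L ∸ a) = ≈-refl
  ... | truncated e e' rewrite e | e' =
    ≈-trans (at (shift-zero k (DegLt0⇒≋[] d)) _) (≈-sym (vanishes d 0 z≤n))

  coefficients : ∀ n → Poly → Fin n → Fin q
  coefficients n f i = index (coeff f (toℕ i))

  encode : ∀ n → Poly → Fin (q ^ n)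
  encode n f = funToFin (coefficients n f)

  encode-injective : ∀ n {f g} → DegLt n f → DegLt n g → encode n f ≡ encode n g → f ≋ g
  encode-injective n {f} {g} df dg e = mk≋ λ i → case i ℕ.<? n of λ where
      (yes i<n) → index-injective (same-index i<n)
      (no i≮n)  → ≈-trans (vanishes df i (ℕₚ.≮⇒≥ i≮n)) (≈-sym (vanishes dg i (ℕₚ.≮⇒≥ i≮n)))
    where
    same-index : ∀ {i} (i<n : i < n) → index (coeff f i) ≡ index (coeff g i)
    same-index {i} i<n =
      ≡.subst (λ k → index (coeff f k) ≡ index (coeff g k)) (Finₚ.toℕ-fromℕ< i<n)
        (≡.trans (≡.sym (Finₚ.finToFun-funToFin (coefficients n f) j))
          (≡.trans (≡.cong (λ x → finToFun {q} {n} x j) e) (Finₚ.finToFun-funToFin (coefficients n g) j)))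
      where j = Fin.fromℕ< i<n

  infix 4 _≋²_
  record _≋²_ (u v : Vec2) : Set where
    constructor _,_
    field
      fst : proj₁ u ≋ proj₁ v
      snd : proj₂ u ≋ proj₂ v

  ≋²-refl : ∀ {u} → u ≋² u
  ≋²-refl = ≋-refl , ≋-refl

  ≋²-sym : ∀ {u v} → u ≋² v → v ≋² u
  ≋²-sym (p , p') = ≋-sym p , ≋-sym p'

  ≋²-trans : ∀ {u v w} → u ≋² v → v ≋² w → u ≋² w
  ≋²-trans (p , p') (q₁ , q₂) = ≋-trans p q₁ , ≋-trans p' q₂

  ≋²⇒≈v : ∀ {u v} → u ≋² v → u ≈v v
  ≋²⇒≈v (p , p') = ≋⇒≈ₚ p , ≋⇒≈ₚ p'

  infix 4 _≋²?_
  _≋²?_ : ∀ u v → Dec (u ≋² v)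
  u ≋²? v = map′ (λ (p , p') → p , p') (λ (p , p') → p , p') ((proj₁ u ≋? proj₁ v) ×-dec (proj₂ u ≋? proj₂ v))

  zero² : Vec2
  zero² = [] , []

  infixr 7 _·v_
  _·v_ : Carrier → Vec2 → Vec2
  c ·v u = c ·ₚ proj₁ u , c ·ₚ proj₂ u

  Proportional : Vec2 → Vec2 → Set
  Proportional u w = ∃ λ c → w ≋² c ·v u

  ·v-cong : ∀ {c c' u u'} → c ≈ c' → u ≋² u' → c ·v u ≋² c' ·v u'
  ·v-cong c≈c' (p , p') = ·ₚ-cong c≈c' p , ·ₚ-cong c≈c' p'

  ·v-assoc : ∀ c b u → (c * b) ·v u ≋² c ·v (b ·v u)
  ·v-assoc c b u = ·ₚ-assoc c b (proj₁ u) , ·ₚ-assoc c b (proj₂ u)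

  +v-cancelʳ : ∀ {u u' v v'} → u +v v ≋² u' +v v' → v ≋² v' → u ≋² u'
  +v-cancelʳ (p , p') (q₁ , q₂) = +ₚ-cancelʳ p q₁ , +ₚ-cancelʳ p' q₂

  ∙v-congˡ : ∀ {a a'} u → a ≋ a' → a ∙v u ≋² a' ∙v u
  ∙v-congˡ u p = *ₚ-congˡ (proj₁ u) p , *ₚ-congˡ (proj₂ u) p

  constant-∙v : ∀ c u → (c ∷ []) ∙v u ≋² c ·v u
  constant-∙v c u = constant-*ₚ c (proj₁ u) , constant-*ₚ c (proj₂ u)

  +v-exchange : ∀ {u u' v v'} → u +v v ≋² u' +v v' → v -v v' ≋² u' -v u
  +v-exchange {u} {u'} {v} {v'} (p , p') =
    exchange (proj₁ u) (proj₁ u') (proj₁ v) (proj₁ v') p , exchange (proj₂ u) (proj₂ u') (proj₂ v) (proj₂ v') p'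
    where
    exchange : ∀ f f' g g' → f +ₚ g ≋ f' +ₚ g' → g +ₚ (-ₚ g') ≋ f' +ₚ (-ₚ f)
    exchange f f' g g' e = +ₚ-pointwise g (-ₚ g') f' (-ₚ f) λ i → begin
      coeff g i + coeff (-ₚ g') i ≈⟨ +-congˡ (coeff-negₚ g' i) ⟩
      coeff g i - coeff g' i      ≈⟨ +-exchange (≈-trans (≈-sym (coeff-+ₚ f g i))
                                                   (≈-trans (at e i) (coeff-+ₚ f' g' i))) ⟩
      coeff f' i - coeff f i      ≈⟨ +-congˡ (coeff-negₚ f i) ⟨
      coeff f' i + coeff (-ₚ f) i ∎

  Proportional? : ∀ u w → Dec (Proportional u w)
  Proportional? u w = map′ (λ (i , w≋) → enum i , w≋)
                           (λ (c , w≋) → index c , ≋²-trans w≋ (·v-cong (≈-sym (enum-index c)) ≋²-refl))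
                           (Finₚ.any? λ i → w ≋²? enum i ·v u)

  proportional-count : ∀ {n} (v : Fin n → Vec2) → (∀ i j → v i ≋² v j → i ≡ j) →
    ∀ u → (∀ j → Proportional u (v j)) → n ≤ q
  proportional-count v v-injective u proportional = Finₚ.injective⇒≤ {f = index ∘ proj₁ ∘ proportional} injective
    where
    injective : ∀ {i j} → index (proj₁ (proportional i)) ≡ index (proj₁ (proportional j)) → i ≡ j
    injective {i} {j} e = v-injective i j
      (≋²-trans (proj₂ (proportional i))
        (≋²-trans (·v-cong (index-injective e) ≋²-refl) (≋²-sym (proj₂ (proportional j)))))

  ≡⇒≋² : ∀ {u v} → u ≡ v → u ≋² v
  ≡⇒≋² ≡.refl = ≋²-refl

  record Distinct (P : Vec2 → Set) (M : ℕ) : Set where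
    field
      vec : Fin M → Vec2
      vec-satisfies : ∀ i → P (vec i)
      vec-injective : ∀ i j → vec i ≋² vec j → i ≡ j

  translates : ∀ {P Q : Vec2 → Set} {M k} (Φ : Distinct P M) (t : Fin k → Vec2) →
    (∀ {x} → P x → ∀ j → Q (x +v t j)) →
    (∀ {x x'} → P x → P x' → ∀ j j' → x +v t j ≋² x' +v t j' → j ≡ j') →
    Distinct Q (M ℕ.* k)
  translates {M = M} {k} Φ t translate-satisfies t-determined = record
    { vec = λ n → vec (quotient n) +v t (remainder n)
    ; vec-satisfies = λ n → translate-satisfies (vec-satisfies (quotient n)) (remainder n)
    ; vec-injective = injective }
    where
    open Distinct Φ
    quotient : Fin (M ℕ.* k) → Fin M
    quotient n = proj₁ (remQuot {M} k n)
    remainder : Fin (M ℕ.* k) → Fin k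
    remainder n = proj₂ (remQuot {M} k n)
    injective : ∀ n n' → vec (quotient n) +v t (remainder n) ≋² vec (quotient n') +v t (remainder n') → n ≡ n'
    injective n n' e = remQuot-injective {M} k n n' (≡.cong₂ _,_ same-quotient same-remainder)
      where
      same-remainder : remainder n ≡ remainder n'
      same-remainder = t-determined (vec-satisfies _) (vec-satisfies _) _ _ e
      same-quotient : quotient n ≡ quotient n'
      same-quotient = vec-injective _ _ (+v-cancelʳ e (≡⇒≋² (≡.cong t same-remainder)))

  -- F[x]-linear combinations of two vectors

  InSpan : Vec2 → Vec2 → Vec2 → Set
  InSpan p₁ p₂ u = ∃₂ λ a₁ a₂ → u ≋² (a₁ ∙v p₁) +v (a₂ ∙v p₂)

  InSpan-swap : ∀ {p₁ p₂ u} → InSpan p₁ p₂ u → InSpan p₂ p₁ u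
  InSpan-swap {p₁} {p₂} (a₁ , a₂ , p , p') =
    a₂ , a₁ , ≋-trans p (+ₚ-comm (a₁ *ₚ proj₁ p₁) _) , ≋-trans p' (+ₚ-comm (a₁ *ₚ proj₂ p₁) _)

  InSpan-zero : ∀ {p₁ p₂ u} → InSpan p₁ p₂ u → p₂ ≋² zero² → ∃ λ a → u ≋² a ∙v p₁
  InSpan-zero {p₁} (a₁ , a₂ , p , p') (z , z') =
    a₁ , ≋-trans p (factor (proj₁ p₁) z) , ≋-trans p' (factor (proj₂ p₁) z')
    where
    factor : ∀ g {g'} → g' ≋ [] → (a₁ *ₚ g) +ₚ (a₂ *ₚ g') ≋ a₁ *ₚ g
    factor g z = ≋-trans (+ₚ-cong ≋-refl (≋-trans (*ₚ-congʳ a₂ z) (*ₚ-zeroʳ a₂))) (+ₚ-identityʳ _)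

  InSpan-left : ∀ p₁ p₂ → InSpan p₁ p₂ p₁
  InSpan-left p₁ p₂ = 1# ∷ [] , [] , ≋-sym (one (proj₁ p₁)) , ≋-sym (one (proj₂ p₁))
    where
    one : ∀ g → (1# ∷ []) *ₚ g +ₚ [] ≋ g
    one g = ≋-trans (+ₚ-identityʳ _) (≋-trans (constant-*ₚ 1# g) (1·ₚ g))

  +ₚ-eliminate : ∀ a₁ a₂ c k g₁ g₂ → let m = monomial c k in
    (a₁ *ₚ g₁) +ₚ (a₂ *ₚ g₂) ≋ ((a₁ +ₚ (m *ₚ a₂)) *ₚ g₁) +ₚ (a₂ *ₚ (g₂ +ₚ (-ₚ (m *ₚ g₁))))
  +ₚ-eliminate a₁ a₂ c k g₁ g₂ =
    ≋-trans (+ₚ-cong (≋-refl {a₁ *ₚ g₁}) split)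
    (≋-trans (≋-trans (+ₚ-cong (≋-refl {A}) (+ₚ-comm B C)) (≋-sym (+ₚ-assoc A C B)))
             (+ₚ-cong (≋-sym (*ₚ-distribʳ a₁ (m *ₚ a₂) g₁)) ≋-refl))
    where
    m A B C : Poly
    m = monomial c k
    A = a₁ *ₚ g₁
    B = a₂ *ₚ (g₂ +ₚ (-ₚ (m *ₚ g₁)))
    C = (m *ₚ a₂) *ₚ g₁
    split : a₂ *ₚ g₂ ≋ B +ₚ C
    split = ≋-trans (*ₚ-congʳ a₂ (≋-sym (-ₚ-inverseʳ g₂ (m *ₚ g₁))))
            (≋-trans (*ₚ-distribˡ a₂ _ (m *ₚ g₁))
                     (+ₚ-cong ≋-refl (*ₚ-monomial-swap a₂ c k g₁)))

  InSpan-eliminate : ∀ c k {p₁ p₂ u} → InSpan p₁ p₂ u → InSpan p₁ (p₂ -v (monomial c k ∙v p₁)) u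
  InSpan-eliminate c k {p₁} {p₂} (a₁ , a₂ , p , p') =
    a₁ +ₚ (monomial c k *ₚ a₂) , a₂ ,
    ≋-trans p (+ₚ-eliminate a₁ a₂ c k (proj₁ p₁) (proj₁ p₂)) ,
    ≋-trans p' (+ₚ-eliminate a₁ a₂ c k (proj₂ p₁) (proj₂ p₂))

  module Boxes (r s : ℕ) where

    -- Box L is {(g , h) : deg g < L ∸ s, deg h < L ∸ r}; the vectors of the theorem lie in box (1 + r + s).
    record InBox (L : ℕ) (u : Vec2) : Set where
      constructor box
      field
        fst : DegLt (L ∸ s) (proj₁ u)
        snd : DegLt (L ∸ r) (proj₂ u)

    L₀ : ℕ
    L₀ = suc (r ℕ.+ s)

    K+L₀∸s : ∀ K → (K ℕ.+ L₀) ∸ s ≡ K ℕ.+ suc r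
    K+L₀∸s K = ≡.trans (≡.cong (_∸ s) (≡.sym (ℕₚ.+-assoc K (suc r) s))) (ℕₚ.m+n∸n≡m (K ℕ.+ suc r) s)

    K+L₀∸r : ∀ K → (K ℕ.+ L₀) ∸ r ≡ K ℕ.+ suc s
    K+L₀∸r K = ≡.trans (≡.cong (_∸ r) (reorder K r s)) (ℕₚ.m+n∸n≡m (K ℕ.+ suc s) r)
      where
      reorder : ∀ K r s → K ℕ.+ suc (r ℕ.+ s) ≡ K ℕ.+ suc s ℕ.+ r
      reorder = solve-∀

    DegLe⇒InBox : ∀ {g h} → DegLe r g → DegLe s h → InBox L₀ (g , h)
    DegLe⇒InBox {g} {h} dg dh =
      box (≡.subst (λ n → DegLt n g) (≡.sym (K+L₀∸s 0)) (degLt dg))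
          (≡.subst (λ n → DegLt n h) (≡.sym (K+L₀∸r 0)) (degLt dh))

    width : Vec2 → ℕ
    width u = length (proj₁ u) ⊔ length (proj₂ u)

    InBox-width : ∀ {K u} → width u ≤ K → InBox (K ℕ.+ L₀) u
    InBox-width {K} {g , h} width≤K =
      box (DegLt-mono (fits (ℕₚ.m≤m⊔n _ _) (K+L₀∸s K)) (DegLt-length g))
          (DegLt-mono (fits (ℕₚ.m≤n⊔m _ _) (K+L₀∸r K)) (DegLt-length h))
      where
      fits : ∀ {n b a} → n ≤ width (g , h) → b ≡ K ℕ.+ a → n ≤ b
      fits {a = a} n≤width b≡K+a =
        ℕₚ.≤-trans n≤width (ℕₚ.≤-trans width≤K (ℕₚ.≤-trans (ℕₚ.m≤m+n K a) (ℕₚ.≤-reflexive (≡.sym b≡K+a))))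

    -- The two coefficients of a vector of box (suc L) that vanish exactly when it lies in box L.
    top : ℕ → Vec2 → Pair
    top L u = coeff (proj₁ u) (L ∸ s) , coeff (proj₂ u) (L ∸ r)

    InBox-resp : ∀ {L u v} → u ≋² v → InBox L u → InBox L v
    InBox-resp (p , p') (box d d') = box (DegLt-resp p d) (DegLt-resp p' d')

    InBox-suc : ∀ {L u} → InBox L u → InBox (suc L) u
    InBox-suc {L} (box d d') = box (DegLt-mono (ℕₚ.∸-monoˡ-≤ s (ℕₚ.n≤1+n L)) d)
                                   (DegLt-mono (ℕₚ.∸-monoˡ-≤ r (ℕₚ.n≤1+n L)) d')

    InBox-+v : ∀ {L u v} → InBox L u → InBox L v → InBox L (u +v v)
    InBox-+v (box d d') (box e e') = box (DegLt-+ₚ d e) (DegLt-+ₚ d' e')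

    InBox-sub : ∀ {L u v} → InBox L u → InBox L v → InBox L (u -v v)
    InBox-sub (box d d') (box e e') = box (DegLt-+ₚ d (DegLt-negₚ e)) (DegLt-+ₚ d' (DegLt-negₚ e'))

    InBox-step : ∀ {L u} → InBox (suc L) u → IsZero² (top L u) → InBox L u
    InBox-step {L} (box d d') (z , z') = box (DegLt-step∸ L s d z) (DegLt-step∸ L r d' z')

    InBox⇒top≈0 : ∀ {L u} → InBox L u → IsZero² (top L u)
    InBox⇒top≈0 {L} (box d d') = vanishes d (L ∸ s) ℕₚ.≤-refl , vanishes d' (L ∸ r) ℕₚ.≤-refl

    InBox0⇒≋zero : ∀ {u} → InBox 0 u → u ≋² zero²
    InBox0⇒≋zero {u} (box d d') =
      DegLt0⇒≋[] (≡.subst (λ n → DegLt n (proj₁ u)) (ℕₚ.0∸n≡0 s) d) ,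
      DegLt0⇒≋[] (≡.subst (λ n → DegLt n (proj₂ u)) (ℕₚ.0∸n≡0 r) d')

    top-resp : ∀ L {u v} → u ≋² v → top L u ≈² top L v
    top-resp L (p , p') = at p _ , at p' _

    top-+v : ∀ L u v → top L (u +v v) ≈² top L u +² top L v
    top-+v L u v = coeff-+ₚ (proj₁ u) (proj₁ v) _ , coeff-+ₚ (proj₂ u) (proj₂ v) _

    top-sub : ∀ L u v → top L u ≈² top L v → IsZero² (top L (u -v v))
    top-sub L u v (e , e') = cancel (proj₁ u) (proj₁ v) e , cancel (proj₂ u) (proj₂ v) e'
      where
      cancel : ∀ f g {i} → coeff f i ≈ coeff g i → coeff (f +ₚ (-ₚ g)) i ≈ 0#
      cancel f g {i} f≈g = begin
        coeff (f +ₚ (-ₚ g)) i   ≈⟨ coeff-+ₚ f (-ₚ g) i ⟩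
        coeff f i + coeff (-ₚ g) i ≈⟨ +-cong f≈g (coeff-negₚ g i) ⟩
        coeff g i - coeff g i   ≈⟨ -‿inverseʳ _ ⟩
        0#                      ∎

    monomial-∙v-shifted : ∀ c d {l e} → InBox (suc l) e →
      InBox (suc (d ℕ.+ l)) (monomial c d ∙v e) × top (d ℕ.+ l) (monomial c d ∙v e) ≈² c ·² top l e
    monomial-∙v-shifted c d {l} {e} (box d₁ d₂) =
      InBox-resp (≋-sym (monomial-*ₚ c d g) , ≋-sym (monomial-*ₚ c d h))
        (≡.subst (λ L → InBox L (shift d (c ·ₚ g) , shift d (c ·ₚ h))) (ℕₚ.+-suc d l)
          (box (DegLt-shift∸ (suc l) s d (DegLt-·ₚ c d₁)) (DegLt-shift∸ (suc l) r d (DegLt-·ₚ c d₂)))) ,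
      leading s g d₁ , leading r h d₂
      where
      g h : Poly
      g = proj₁ e
      h = proj₂ e
      leading : ∀ a f → DegLt (suc l ∸ a) f →
        coeff (monomial c d *ₚ f) ((d ℕ.+ l) ∸ a) ≈ c * coeff f (l ∸ a)
      leading a f df = ≈-trans (at (monomial-*ₚ c d f) _)
                         (≈-trans (coeff-shift∸ l a d (DegLt-·ₚ c df)) (coeff-·ₚ c f (l ∸ a)))

    monomial-∙v-InBox : ∀ c {l L e} → l ≤ L → InBox (suc l) e →
      InBox (suc L) (monomial c (L ∸ l) ∙v e) × top L (monomial c (L ∸ l) ∙v e) ≈² c ·² top l e
    monomial-∙v-InBox c {l} {L} {e} l≤L b =
      ≡.subst (λ L' → InBox (suc L') (monomial c (L ∸ l) ∙v e) × top L' (monomial c (L ∸ l) ∙v e) ≈² c ·² top l e)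
        (ℕₚ.m∸n+n≡m l≤L) (monomial-∙v-shifted c (L ∸ l) b)

    InBox-count : ∀ {L M} → Distinct (InBox L) M → M ≤ q ^ (L ∸ s) ℕ.* q ^ (L ∸ r)
    InBox-count {L} {M} Φ = Finₚ.injective⇒≤ {f = code} injective
      where
      open Distinct Φ
      code : Fin M → Fin (q ^ (L ∸ s) ℕ.* q ^ (L ∸ r))
      code i = combine (encode (L ∸ s) (proj₁ (vec i))) (encode (L ∸ r) (proj₂ (vec i)))
      injective : ∀ {i j} → code i ≡ code j → i ≡ j
      injective {i} {j} e =
        let e₁ , e₂ = Finₚ.combine-injective _ _ _ _ e
            box d₁ d₂ = vec-satisfies i
            box d₁' d₂' = vec-satisfies j
        in vec-injective i j (encode-injective (L ∸ s) d₁ d₁' e₁ , encode-injective (L ∸ r) d₂ d₂' e₂)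

    module Lattice (Γ : Submodule2) where

      ∈-resp : ∀ {u v} → u ≋² v → mem Γ u → mem Γ v
      ∈-resp e = mem-resp Γ (≋²⇒≈v e)

      ∈-·v : ∀ c {u} → mem Γ u → mem Γ (c ·v u)
      ∈-·v c u∈Γ = ∈-resp (constant-∙v c _) (mem-∙ Γ (c ∷ []) u∈Γ)

      ∈-sub : ∀ {u v} → mem Γ u → mem Γ v → mem Γ (u -v v)
      ∈-sub {v = v} u∈Γ v∈Γ = mem-+ Γ u∈Γ (∈-resp (-1·ₚ (proj₁ v) , -1·ₚ (proj₂ v)) (∈-·v (- 1#) v∈Γ))

      record ReducedPair : Set where
        field
          e₁ e₂ : Vec2
          l₁ l₂ : ℕ
          e₁∈Γ : mem Γ e₁
          e₂∈Γ : mem Γ e₂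
          e₁∈box : InBox (suc l₁) e₁
          e₂∈box : InBox (suc l₂) e₂
          l₁<L₀ : l₁ < L₀
          l₂<L₀ : l₂ < L₀
          independent : Independent (top l₁ e₁) (top l₂ e₂)

      CommonFactor : Vec2 → Vec2 → Set
      CommonFactor u w = ∃ λ z → mem Γ z × ∃₂ λ a b → (u ≋² a ∙v z) × (w ≋² b ∙v z)

      -- The state of a Euclid-style reduction of the pair (u , w) inside Γ.
      record Generators (u w : Vec2) (l₁ l₂ : ℕ) : Set where
        field
          p₁ p₂ : Vec2
          p₁∈Γ : mem Γ p₁
          p₂∈Γ : mem Γ p₂
          p₁∈box : InBox l₁ p₁
          p₂∈box : InBox l₂ p₂
          l₁≤L₀ : l₁ ≤ L₀
          l₂≤L₀ : l₂ ≤ L₀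
          u∈span : InSpan p₁ p₂ u
          w∈span : InSpan p₁ p₂ w

      module _ {u w : Vec2} where

        swap : ∀ {l₁ l₂} → Generators u w l₁ l₂ → Generators u w l₂ l₁
        swap σ = record
          { p₁ = p₂ ; p₂ = p₁ ; p₁∈Γ = p₂∈Γ ; p₂∈Γ = p₁∈Γ ; p₁∈box = p₂∈box ; p₂∈box = p₁∈box
          ; l₁≤L₀ = l₂≤L₀ ; l₂≤L₀ = l₁≤L₀ ; u∈span = InSpan-swap u∈span ; w∈span = InSpan-swap w∈span }
          where open Generators σ

        lower : ∀ {k₁ l₂} (σ : Generators u w (suc k₁) l₂) → IsZero² (top k₁ (Generators.p₁ σ)) →
          Generators u w k₁ l₂
        lower σ top≈0 = record
          { p₁ = p₁ ; p₂ = p₂ ; p₁∈Γ = p₁∈Γ ; p₂∈Γ = p₂∈Γ ; p₁∈box = InBox-step p₁∈box top≈0 ; p₂∈box = p₂∈box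
          ; l₁≤L₀ = ℕₚ.≤-trans (ℕₚ.n≤1+n _) l₁≤L₀ ; l₂≤L₀ = l₂≤L₀ ; u∈span = u∈span ; w∈span = w∈span }
          where open Generators σ

        eliminate : ∀ {k₁ k₂} (σ : Generators u w (suc k₁) (suc k₂)) → k₁ ≤ k₂ →
          ∀ {c} → top k₂ (Generators.p₂ σ) ≈² c ·² top k₁ (Generators.p₁ σ) → Generators u w (suc k₁) k₂
        eliminate {k₁} {k₂} σ k₁≤k₂ {c} tops≈ = record
          { p₁ = p₁ ; p₂ = p₂ -v m ; p₁∈Γ = p₁∈Γ ; p₂∈Γ = ∈-sub p₂∈Γ (mem-∙ Γ (monomial c (k₂ ∸ k₁)) p₁∈Γ)
          ; p₁∈box = p₁∈box
          ; p₂∈box = InBox-step (InBox-sub p₂∈box m∈box)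
                       (top-sub k₂ p₂ m (≈²-trans tops≈ (≈²-sym top-m)))
          ; l₁≤L₀ = l₁≤L₀ ; l₂≤L₀ = ℕₚ.≤-trans (ℕₚ.n≤1+n _) l₂≤L₀
          ; u∈span = InSpan-eliminate c (k₂ ∸ k₁) u∈span ; w∈span = InSpan-eliminate c (k₂ ∸ k₁) w∈span }
          where
          open Generators σ
          m : Vec2
          m = monomial c (k₂ ∸ k₁) ∙v p₁
          m∈box : InBox (suc k₂) m
          m∈box = proj₁ (monomial-∙v-InBox c k₁≤k₂ p₁∈box)
          top-m : top k₂ m ≈² c ·² top k₁ p₁
          top-m = proj₂ (monomial-∙v-InBox c k₁≤k₂ p₁∈box)

        common-factor : ∀ {l₁} → Generators u w l₁ 0 → CommonFactor u w
        common-factor σ =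
          let a , u≋ = InSpan-zero u∈span (InBox0⇒≋zero p₂∈box)
              b , w≋ = InSpan-zero w∈span (InBox0⇒≋zero p₂∈box)
          in p₁ , p₁∈Γ , a , b , u≋ , w≋
          where open Generators σ

        reduced : ∀ {k₁ k₂} (σ : Generators u w (suc k₁) (suc k₂)) →
          Independent (top k₁ (Generators.p₁ σ)) (top k₂ (Generators.p₂ σ)) → ReducedPair
        reduced {k₁} {k₂} σ independent = record
          { e₁ = p₁ ; e₂ = p₂ ; l₁ = k₁ ; l₂ = k₂ ; e₁∈Γ = p₁∈Γ ; e₂∈Γ = p₂∈Γ ; e₁∈box = p₁∈box ; e₂∈box = p₂∈box
          ; l₁<L₀ = l₁≤L₀ ; l₂<L₀ = l₂≤L₀ ; independent = independent }
          where open Generators σ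

        reduce : ∀ n {l₁ l₂} → l₁ ℕ.+ l₂ ≤ n → Generators u w l₁ l₂ → ReducedPair ⊎ CommonFactor u w
        reduce _ {l₂ = zero} _ σ = inj₂ (common-factor σ)
        reduce _ {zero} {suc _} _ σ = inj₂ (common-factor (swap σ))
        reduce (suc n) {suc k₁} {suc k₂} (s≤s bound) σ
          with IsZero²? (top k₁ (Generators.p₁ σ)) | IsZero²? (top k₂ (Generators.p₂ σ))
        ... | yes top₁≈0 | _ = reduce n bound (lower σ top₁≈0)
        ... | no _ | yes top₂≈0 = reduce n (≡.subst (_≤ n) (ℕₚ.+-suc k₁ k₂) bound) (swap (lower (swap σ) top₂≈0))
        ... | no top₁≉0 | no top₂≉0
          with independent-or-dependent (top k₁ (Generators.p₁ σ)) (top k₂ (Generators.p₂ σ))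
        ...   | inj₁ independent = inj₁ (reduced σ independent)
        ...   | inj₂ dependent with k₁ ℕ.≤? k₂
        ...     | yes k₁≤k₂ = reduce n (≡.subst (_≤ n) (ℕₚ.+-suc k₁ k₂) bound)
                    (eliminate σ k₁≤k₂ (proj₂ (dependent⇒proportional top₁≉0 dependent)))
        ...     | no k₁≰k₂ = reduce n bound
                    (swap (eliminate (swap σ) (ℕₚ.≰⇒≥ k₁≰k₂)
                      (proj₂ (dependent⇒proportional top₂≉0 (Dependent-sym dependent)))))

      Primitive⇒≉zero : ∀ {u} → Primitive Γ u → ¬ (u ≋² zero²)
      Primitive⇒≉zero {u} (_ , not-multiple) u≋0 =
        not-multiple (x , zero² , mem-0 Γ , deg-x , ≋²⇒≈v (≋²-trans u≋0 (≋-sym (*ₚ-zeroʳ x) , ≋-sym (*ₚ-zeroʳ x))))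
        where
        x : Poly
        x = 0# ∷ 1# ∷ []
        deg-x : DegGe1 x
        deg-x = 1 , s≤s z≤n , λ 1≈0 → 0≉1 (≈-sym 1≈0)

      Primitive-multiple : ∀ {u z} a → Primitive Γ u → mem Γ z → u ≋² a ∙v z → u ≋² coeff a 0 ·v z
      Primitive-multiple {u} {z} a (_ , not-multiple) z∈Γ u≋az =
        ≋²-trans u≋az (≋²-trans (∙v-congˡ z a≋constant) (constant-∙v (coeff a 0) z))
        where
        a≋constant : a ≋ coeff a 0 ∷ []
        a≋constant = mk≋ λ where
          zero → ≈-refl
          (suc i) → case coeff a (suc i) ≟ 0# of λ where
            (yes aᵢ≈0) → aᵢ≈0
            (no aᵢ≉0) → ⊥-elim (not-multiple (a , z , z∈Γ , (suc i , s≤s z≤n , aᵢ≉0) , ≋²⇒≈v u≋az))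

      common-factor⇒proportional : ∀ {u w} → Primitive Γ u → Primitive Γ w → CommonFactor u w → Proportional u w
      common-factor⇒proportional {u} {w} u-primitive w-primitive (z , z∈Γ , a , b , u≋az , w≋bz)
        with coeff a 0 ≟ 0#
      ... | yes α≈0 = ⊥-elim (Primitive⇒≉zero u-primitive
              (≋²-trans u≋αz (≋²-trans (·v-cong α≈0 ≋²-refl) (0·ₚ (proj₁ z) , 0·ₚ (proj₂ z)))))
        where
        u≋αz : u ≋² coeff a 0 ·v z
        u≋αz = Primitive-multiple a u-primitive z∈Γ u≋az
      ... | no α≉0 with α⁻¹ , αα⁻¹≈1 ← inverse (coeff a 0) α≉0 = coeff b 0 * α⁻¹ ,
        ≋²-trans (Primitive-multiple b w-primitive z∈Γ w≋bz)
                 (≋²-trans (·v-cong ≈-refl z≋α⁻¹u) (≋²-sym (·v-assoc (coeff b 0) α⁻¹ u)))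
        where
        z≋α⁻¹u : z ≋² α⁻¹ ·v u
        z≋α⁻¹u = ≋²-sym (≋²-trans (·v-cong ≈-refl (Primitive-multiple a u-primitive z∈Γ u≋az))
                   (≋²-trans (≋²-sym (·v-assoc α⁻¹ (coeff a 0) z))
                   (≋²-trans (·v-cong (≈-trans (*-comm _ _) αα⁻¹≈1) ≋²-refl) (1·ₚ (proj₁ z) , 1·ₚ (proj₂ z)))))

      LatticeBox : ℕ → Vec2 → Set
      LatticeBox L u = mem Γ u × InBox L u

      module _ (ρ : ReducedPair) where
        open ReducedPair ρ

        raise : ∀ {L M} → l₁ ≤ L → l₂ ≤ L →
          Distinct (LatticeBox L) M → Distinct (LatticeBox (suc L)) (M ℕ.* (q ℕ.* q))
        raise {L} l₁≤L l₂≤L Φ = translates Φ (λ j → T (enum (a j)) (enum (b j))) satisfies determined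
          where
          a b : Fin (q ℕ.* q) → Fin q
          a j = proj₁ (remQuot {q} q j)
          b j = proj₂ (remQuot {q} q j)
          T : Carrier → Carrier → Vec2
          T x y = (monomial x (L ∸ l₁) ∙v e₁) +v (monomial y (L ∸ l₂) ∙v e₂)
          T∈Γ : ∀ x y → mem Γ (T x y)
          T∈Γ x y = mem-+ Γ (mem-∙ Γ (monomial x (L ∸ l₁)) e₁∈Γ) (mem-∙ Γ (monomial y (L ∸ l₂)) e₂∈Γ)
          T∈box : ∀ x y → InBox (suc L) (T x y)
          T∈box x y = InBox-+v (proj₁ (monomial-∙v-InBox x l₁≤L e₁∈box)) (proj₁ (monomial-∙v-InBox y l₂≤L e₂∈box))
          top-translate : ∀ {v} x y → InBox L v → top L (v +v T x y) ≈² x ·² top l₁ e₁ +² y ·² top l₂ e₂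
          top-translate {v} x y v∈box =
            ≈²-trans (top-+v L v (T x y))
            (≈²-trans (+²-zeroˡ _ (InBox⇒top≈0 v∈box))
            (≈²-trans (top-+v L (monomial x (L ∸ l₁) ∙v e₁) (monomial y (L ∸ l₂) ∙v e₂))
                      (+²-cong (proj₂ (monomial-∙v-InBox x l₁≤L e₁∈box))
                               (proj₂ (monomial-∙v-InBox y l₂≤L e₂∈box)))))
          satisfies : ∀ {v} → LatticeBox L v → ∀ j → LatticeBox (suc L) (v +v T (enum (a j)) (enum (b j)))
          satisfies (v∈Γ , v∈box) j = mem-+ Γ v∈Γ (T∈Γ _ _) , InBox-+v (InBox-suc v∈box) (T∈box _ _)
          determined : ∀ {v v'} → LatticeBox L v → LatticeBox L v' → ∀ j j' →
            v +v T (enum (a j)) (enum (b j)) ≋² v' +v T (enum (a j')) (enum (b j')) → j ≡ j'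
          determined (_ , v∈box) (_ , v'∈box) j j' e =
            let a≈a' , b≈b' = independent⇒injective independent
                                (≈²-trans (≈²-sym (top-translate _ _ v∈box))
                                (≈²-trans (top-resp L e) (top-translate _ _ v'∈box)))
            in remQuot-injective {q} q j j' (≡.cong₂ _,_ (enum-inj _ _ a≈a') (enum-inj _ _ b≈b'))

        raise-iterated : ∀ {N} → Distinct (LatticeBox L₀) N →
          ∀ K → Distinct (LatticeBox (K ℕ.+ L₀)) (N ℕ.* (q ℕ.* q) ^ K)
        raise-iterated {N} Φ zero = ≡.subst (Distinct (LatticeBox L₀)) (≡.sym (ℕₚ.*-identityʳ N)) Φ
        raise-iterated {N} Φ (suc K) =
          ≡.subst (Distinct (LatticeBox (suc K ℕ.+ L₀)))
            (≡.trans (ℕₚ.*-assoc N ((q ℕ.* q) ^ K) (q ℕ.* q)) (≡.cong (N ℕ.*_) (ℕₚ.*-comm _ (q ℕ.* q))))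
            (raise (below L₀ l₁<L₀) (below L₀ l₂<L₀) (raise-iterated Φ K))
          where
          below : ∀ {l} L → l < L → l ≤ K ℕ.+ L
          below L l<L = ℕₚ.≤-trans (ℕₚ.<⇒≤ l<L) (ℕₚ.m≤n+m L K)

      add-representatives : ∀ {L M N} ((rep , _) : HasIndex Γ N) → (∀ j → InBox L (rep j)) →
        Distinct (LatticeBox L) M → Distinct (InBox L) (M ℕ.* N)
      add-representatives (rep , rep-distinct , _) rep∈box Φ = translates Φ rep
        (λ (_ , v∈box) j → InBox-+v v∈box (rep∈box j))
        (λ {v} {v'} (v∈Γ , _) (v'∈Γ , _) j j' e →
           rep-distinct j j' (∈-resp (≋²-sym (+v-exchange {v} {v'} e)) (∈-sub v'∈Γ v∈Γ)))

      reduced-pair-count : ∀ {m N} → ReducedPair → HasIndex Γ (q ^ m) → Distinct (LatticeBox L₀) N →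
        N ≤ q ^ ((r ℕ.+ s ℕ.+ 2) ∸ m)
      reduced-pair-count {m} {N} ρ Γ-index@(rep , _) Φ =
        n*q^[m+c]≤q^[x+c]⇒n≤q^[x∸m] q N (r ℕ.+ s ℕ.+ 2) m (K ℕ.+ K) 2≤q
          (≡.subst₂ _≤_ family-size box-size
            (InBox-count (add-representatives Γ-index rep∈box (raise-iterated ρ Φ K))))
        where
        K : ℕ
        K = proj₁ (bounded _ (width ∘ rep))
        rep∈box : ∀ j → InBox (K ℕ.+ L₀) (rep j)
        rep∈box j = InBox-width (proj₂ (bounded _ (width ∘ rep)) j)
        family-size : N ℕ.* (q ℕ.* q) ^ K ℕ.* q ^ m ≡ N ℕ.* q ^ (m ℕ.+ (K ℕ.+ K))
        family-size =
          ≡.trans (ℕₚ.*-assoc N _ _)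
            (≡.cong (N ℕ.*_) (≡.trans (≡.cong (ℕ._* q ^ m) ([q*q]^k≡q^[k+k] q K))
              (≡.trans (≡.sym (ℕₚ.^-distribˡ-+-* q (K ℕ.+ K) m)) (≡.cong (q ^_) (ℕₚ.+-comm (K ℕ.+ K) m)))))
        box-size : q ^ ((K ℕ.+ L₀) ∸ s) ℕ.* q ^ ((K ℕ.+ L₀) ∸ r) ≡ q ^ (r ℕ.+ s ℕ.+ 2 ℕ.+ (K ℕ.+ K))
        box-size =
          ≡.trans (≡.cong₂ (λ a b → q ^ a ℕ.* q ^ b) (K+L₀∸s K) (K+L₀∸r K))
            (≡.trans (≡.sym (ℕₚ.^-distribˡ-+-* q (K ℕ.+ suc r) (K ℕ.+ suc s))) (≡.cong (q ^_) (regroup K r s)))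
          where
          regroup : ∀ K r s → K ℕ.+ suc r ℕ.+ (K ℕ.+ suc s) ≡ r ℕ.+ s ℕ.+ 2 ℕ.+ (K ℕ.+ K)
          regroup = solve-∀

      nonproportional⇒reduced-pair : ∀ {u w} → Primitive Γ u → Primitive Γ w → InBox L₀ u → InBox L₀ w →
        ¬ Proportional u w → ReducedPair
      nonproportional⇒reduced-pair {u} {w} u-primitive w-primitive u∈box w∈box ¬proportional
        with reduce (L₀ ℕ.+ L₀) ℕₚ.≤-refl initial
        where
        initial : Generators u w L₀ L₀
        initial = record
          { p₁ = u ; p₂ = w ; p₁∈Γ = proj₁ u-primitive ; p₂∈Γ = proj₁ w-primitive ; p₁∈box = u∈box ; p₂∈box = w∈box
          ; l₁≤L₀ = ℕₚ.≤-refl ; l₂≤L₀ = ℕₚ.≤-refl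
          ; u∈span = InSpan-left u w ; w∈span = InSpan-swap (InSpan-left w u) }
      ... | inj₁ ρ = ρ
      ... | inj₂ common = ⊥-elim (¬proportional (common-factor⇒proportional u-primitive w-primitive common))

      primitive-family : ∀ {N} (v : Fin N → Vec2) → (∀ i j → v i ≈v v j → i ≡ j) →
        (∀ i → Primitive Γ (v i) × DegLe r (proj₁ (v i)) × DegLe s (proj₂ (v i))) → Distinct (LatticeBox L₀) N
      primitive-family v v-injective v-conditions = record
        { vec = v
        ; vec-satisfies = λ i → let (v∈Γ , _) , deg-g , deg-h = v-conditions i in v∈Γ , DegLe⇒InBox deg-g deg-h
        ; vec-injective = λ i j → v-injective i j ∘ ≋²⇒≈v }

open import Data.Nat using (_+_)

lemma3p3 : (F : FiniteField) → (Γ : Over.Submodule2 F) → (m r s : ℕ) →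
    Over.HasIndex F Γ (FiniteField.q F ^ m) →
    (N : ℕ) → (v : Fin N → Over.Vec2 F) →
    (∀ i j → Over._≈v_ F (v i) (v j) → i ≡ j) →
    (∀ i → Over.Primitive F Γ (v i)
         × Over.DegLe F r (proj₁ (v i))
         × Over.DegLe F s (proj₂ (v i))) →
    N ≤ FiniteField.q F ⊔ FiniteField.q F ^ ((r + s + 2) ∸ m)
lemma3p3 F Γ m r s Γ-index zero v _ _ = z≤n
lemma3p3 F Γ m r s Γ-index (suc N) v v-injective v-conditions =
  case Finₚ.all? (Proportional? u ∘ v) of λ where
    (yes all-proportional) →
      ℕₚ.m≤n⇒m≤n⊔o _ (proportional-count v vec-injective u all-proportional)
    (no ¬all-proportional) →
      ℕₚ.m≤n⇒m≤o⊔n (FiniteField.q F) (reduced-pair-count {m} (reduced-pair ¬all-proportional) Γ-index family)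
  where
  open Over F using (Vec2)
  open Polynomials F
  open Boxes r s
  open Lattice Γ
  family : Distinct (LatticeBox L₀) (suc N)
  family = primitive-family v v-injective v-conditions
  open Distinct family
  u : Vec2
  u = v Fin.zero
  reduced-pair : ¬ (∀ j → Proportional u (v j)) → ReducedPair
  reduced-pair ¬all-proportional =
    let j , ¬proportional = Finₚ.¬∀⟶∃¬ _ _ (Proportional? u ∘ v) ¬all-proportional
    in nonproportional⇒reduced-pair (proj₁ (v-conditions Fin.zero)) (proj₁ (v-conditions j))
         (proj₂ (vec-satisfies Fin.zero)) (proj₂ (vec-satisfies j)) ¬proportional
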